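{- If $(\Lambda,Y)$ is an extensible graph with parameters $(t,s,\bar s)$, then its complement $(\bar\Lambda,Y)$ (same vertex set, edges the non-edges of $\Lambda$) is extensible, with parameters $(\bar t,s',\bar s')$ satisfying $s'=\bar s$, $\bar s'=s$ and $t+\bar t=s+\bar s-2=s'+\bar s'-2$.
   Context: A simple graph $(\Lambda,Y)$ is extensible with parameters $(t,s,\bar s)$ (integers) if: (1) $\Lambda$ has diameter $2$; (2) for every $y\in Y$: (a) the set $\Lambda(y,1)$ of neighbours of $y$ has $2s$ elements; (b) the set $\Lambda(y,2)$ of vertices at distance $2$ from $y$ has $2\bar s$ elements; (c) every $z\in\Lambda(y,1)$ is adjacent to exactly $\bar s$ points of $\Lambda(y,2)$ and exactly $t=2s-\bar s-1$ points of $\Lambda(y,1)$; (d) every $z\in\Lambda(y,2)$ is adjacent to exactly $s$ points of $\Lambda(y,2)$ and exactly $s$ points of $\Lambda(y,1)$; (3) every edge is contained in exactly $t=2s-\bar s-1$ triangles; (4) $|Y|=1+2s+2\bar s$. -}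

module Defs where

open import Data.Nat using (ℕ)
open import Data.Integer using (ℤ; +_; _+_; _-_; _*_)
open import Data.Bool using (Bool; true; false; _∧_; not)
open import Data.Fin using (Fin)
open import Data.Fin.Properties using (_≟_)
open import Data.List using (List; length; filterᵇ)
open import Data.Bool.ListAction using (any)
open import Data.Product using (Σ; ∃; _×_; _,_)
open import Data.Sum using (_⊎_)
open import Relation.Binary.PropositionalEquality using (_≡_; _≢_)
open import Relation.Nullary.Decidable using (⌊_⌋)
import Data.List as L

allV : (n : ℕ) → List (Fin n)
allV n = L.allFin n

count : {n : ℕ} → (Fin n → Bool) → ℕ
count {n} p = length (filterᵇ p (allV n))

exists? : {n : ℕ} → (Fin n → Bool) → Bool
exists? {n} p = any p (allV n)

-- finite simple graph on vertex set Y = Fin n (boolean adjacency)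
record Graph (n : ℕ) : Set where
  field
    adj    : Fin n → Fin n → Bool
    sym    : ∀ x y → adj x y ≡ adj y x
    irrefl : ∀ x → adj x x ≡ false
open Graph public

_==_ : {n : ℕ} → Fin n → Fin n → Bool
x == y = ⌊ x ≟ y ⌋

complement : {n : ℕ} → Graph n → Graph n
complement G = record
  { adj    = λ x y → not (x == y) ∧ not (adj G x y)
  ; sym    = symC
  ; irrefl = irC }
  where
  open import Data.Fin.Properties using ()
  open import Relation.Binary.PropositionalEquality using (refl; cong₂; sym)
  open import Relation.Nullary using (yes; no)
  symC : ∀ x y → (not (x == y) ∧ not (adj G x y)) ≡ (not (y == x) ∧ not (adj G y x))
  symC x y with x ≟ y | y ≟ x
  ... | yes _ | yes _ = refl
  ... | no _  | no _  = cong₂ (λ a b → not a ∧ not b) refl (Graph.sym G x y)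
  ... | yes refl | no ne = Data.Empty.⊥-elim (ne refl)
    where import Data.Empty
  ... | no ne | yes refl = Data.Empty.⊥-elim (ne refl)
    where import Data.Empty
  irC : ∀ x → (not (x == x) ∧ not (adj G x x)) ≡ false
  irC x with x ≟ x
  ... | yes _ = refl
  ... | no ne = Data.Empty.⊥-elim (ne refl)
    where import Data.Empty

module _ {n : ℕ} (G : Graph n) where
  nbr1 : Fin n → Fin n → Bool
  nbr1 y z = adj G y z

  nbr2 : Fin n → Fin n → Bool
  nbr2 y z = not (y == z) ∧ not (adj G y z) ∧ exists? (λ w → adj G y w ∧ adj G w z)

  Diameter2 : Set
  Diameter2 =
    (∀ x y → x ≢ y → adj G x y ≡ true ⊎ Σ (Fin n) (λ w → adj G x w ≡ true × adj G w y ≡ true))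
    × Σ (Fin n) (λ x → Σ (Fin n) (λ y → x ≢ y × adj G x y ≡ false))

  Extensible : ℤ → ℤ → ℤ → Set
  Extensible t s sb =
      Diameter2
    × (t ≡ + 2 * s - sb - + 1)
    × (∀ y → + count (nbr1 y) ≡ + 2 * s)
    × (∀ y → + count (nbr2 y) ≡ + 2 * sb)
    × (∀ y z → nbr1 y z ≡ true →
          (+ count (λ w → nbr2 y w ∧ adj G z w) ≡ sb)
        × (+ count (λ w → nbr1 y w ∧ adj G z w) ≡ t))
    × (∀ y z → nbr2 y z ≡ true →
          (+ count (λ w → nbr2 y w ∧ adj G z w) ≡ s)
        × (+ count (λ w → nbr1 y w ∧ adj G z w) ≡ s))
    × (∀ x y → adj G x y ≡ true →
          + count (λ w → adj G x w ∧ adj G y w) ≡ t)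
    × (+ n ≡ + 1 + + 2 * s + + 2 * sb)

-- Diameter 2 makes Λ(y,2) the set of vertices other than y not adjacent to y, i.e. the
-- neighbourhood of y in the complement.  Splitting a set of vertices relative to z into the
-- neighbours of z, the vertices equal to z, and the remaining ones (the neighbours of z in the
-- complement) turns each parameter of Λ into one of the complement.  The only further point is
-- that the complement again has diameter 2: for an edge yz of Λ this count gives s̄ common
-- non-neighbours, and s̄ > 0 because some Λ(x,2) is nonempty.
module Submission where

open import Defs hiding (sym)
open import Data.Nat using (ℕ; zero; suc) renaming (_+_ to _+ℕ_)
open import Data.Nat.Properties using (+-suc)
open import Data.Integer using (ℤ; +_; _+_; _-_; _*_)
open import Data.Integer.Properties using (pos-+; +-injective; +-comm)
open import Data.Integer.Tactic.RingSolver using (solve-∀)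
open import Data.Fin using (Fin; zero; suc)
open import Data.Fin.Properties using (_≟_)
open import Data.Bool using (Bool; true; false; _∧_; _∨_; not; if_then_else_)
open import Data.Bool.Properties using (∨-zeroʳ; ∧-assoc; ∧-identityʳ; ∧-zeroʳ; not-involutive)
open import Data.Bool.ListAction using (any)
open import Data.List using (List; []; _∷_; length; filterᵇ; map)
open import Data.List.Properties using (map-tabulate)
open import Data.List.Membership.Propositional using (_∈_)
open import Data.List.Membership.Propositional.Properties using (∈-allFin)
open import Data.List.Relation.Unary.Any using (here; there)
open import Data.Product using (Σ; ∃; _×_; _,_; proj₁; proj₂)
open import Data.Sum using (_⊎_; inj₁; inj₂)
open import Data.Empty using (⊥-elim)
open import Function using (_∘_)
open import Relation.Nullary using (yes; no)
open import Relation.Binary.PropositionalEquality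

module _ {A : Set} where

  length-filterᵇ-cong : {p q : A → Bool} → (∀ x → p x ≡ q x) →
    ∀ xs → length (filterᵇ p xs) ≡ length (filterᵇ q xs)
  length-filterᵇ-cong p≗q [] = refl
  length-filterᵇ-cong {p} {q} p≗q (x ∷ xs) rewrite p≗q x with q x
  ... | true  = cong suc (length-filterᵇ-cong p≗q xs)
  ... | false = length-filterᵇ-cong p≗q xs

  length-filterᵇ-split : (p q : A → Bool) → ∀ xs →
    length (filterᵇ p xs) ≡
      length (filterᵇ (λ x → p x ∧ q x) xs) +ℕ length (filterᵇ (λ x → p x ∧ not (q x)) xs)
  length-filterᵇ-split p q [] = refl
  length-filterᵇ-split p q (x ∷ xs) with p x | q x
  ... | true  | true  = cong suc (length-filterᵇ-split p q xs)
  ... | true  | false = trans (cong suc (length-filterᵇ-split p q xs)) (sym (+-suc _ _))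
  ... | false | _     = length-filterᵇ-split p q xs

  length-filterᵇ-map : {B : Set} (p : B → Bool) (f : A → B) → ∀ xs →
    length (filterᵇ p (map f xs)) ≡ length (filterᵇ (p ∘ f) xs)
  length-filterᵇ-map p f [] = refl
  length-filterᵇ-map p f (x ∷ xs) with p (f x)
  ... | true  = cong suc (length-filterᵇ-map p f xs)
  ... | false = length-filterᵇ-map p f xs

  length-filterᵇ-false : ∀ xs → length (filterᵇ (λ (_ : A) → false) xs) ≡ 0
  length-filterᵇ-false [] = refl
  length-filterᵇ-false (x ∷ xs) = length-filterᵇ-false xs

  ∈⇒length-filterᵇ≢0 : {p : A → Bool} {x : A} {xs : List A} →
    x ∈ xs → p x ≡ true → length (filterᵇ p xs) ≢ 0
  ∈⇒length-filterᵇ≢0 {p} {x} (here refl) px rewrite px = λ ()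
  ∈⇒length-filterᵇ≢0 {p} {xs = y ∷ _} (there x∈xs) px with p y
  ... | true  = λ ()
  ... | false = ∈⇒length-filterᵇ≢0 x∈xs px

  length-filterᵇ≢0⇒∃ : {p : A → Bool} → ∀ xs → length (filterᵇ p xs) ≢ 0 → ∃ λ x → p x ≡ true
  length-filterᵇ≢0⇒∃ [] ≢0 = ⊥-elim (≢0 refl)
  length-filterᵇ≢0⇒∃ {p} (x ∷ xs) ≢0 with p x in px
  ... | true  = x , px
  ... | false = length-filterᵇ≢0⇒∃ xs ≢0

  any-∈ : {p : A → Bool} {x : A} {xs : List A} → x ∈ xs → p x ≡ true → any p xs ≡ true
  any-∈ (here refl) px rewrite px = refl
  any-∈ {p} {xs = y ∷ _} (there x∈xs) px = trans (cong (p y ∨_) (any-∈ x∈xs px)) (∨-zeroʳ (p y))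

module _ {n : ℕ} where

  count-cong : {p q : Fin n → Bool} → (∀ w → p w ≡ q w) → count p ≡ count q
  count-cong p≗q = length-filterᵇ-cong p≗q (allV n)

  count-split : (p q : Fin n → Bool) →
    count p ≡ count (λ w → p w ∧ q w) +ℕ count (λ w → p w ∧ not (q w))
  count-split p q = length-filterᵇ-split p q (allV n)

  count-false : count (λ (_ : Fin n) → false) ≡ 0
  count-false = length-filterᵇ-false (allV n)

  count-∧-congˡ : {p q : Fin n → Bool} (r : Fin n → Bool) → (∀ w → p w ≡ q w) →
    count (λ w → p w ∧ r w) ≡ count (λ w → q w ∧ r w)
  count-∧-congˡ r p≗q = count-cong (λ w → cong (_∧ r w) (p≗q w))

  witness⇒count≢0 : {p : Fin n → Bool} (w : Fin n) → p w ≡ true → count p ≢ 0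
  witness⇒count≢0 w = ∈⇒length-filterᵇ≢0 (∈-allFin w)

  count≢0⇒witness : (p : Fin n → Bool) → count p ≢ 0 → ∃ λ w → p w ≡ true
  count≢0⇒witness p = length-filterᵇ≢0⇒∃ (allV n)

  witness⇒exists? : {p : Fin n → Bool} (w : Fin n) → p w ≡ true → exists? p ≡ true
  witness⇒exists? w = any-∈ (∈-allFin w)

indicator : Bool → ℕ
indicator b = if b then 1 else 0

count-suc : ∀ {n} (p : Fin (suc n) → Bool) →
  count p ≡ indicator (p zero) +ℕ count (p ∘ suc)
count-suc {n} p
  with p zero | trans (cong (length ∘ filterᵇ p) (sym (map-tabulate (λ w → w) suc)))
                      (length-filterᵇ-map p suc (allV n))
... | true  | tail = cong suc tail
... | false | tail = tail

suc-==-suc : ∀ {n} (z w : Fin n) → (suc z == suc w) ≡ (z == w)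
suc-==-suc z w with z ≟ w
... | yes _ = refl
... | no _  = refl

count-== : ∀ {n} (z : Fin n) → count (z ==_) ≡ 1
count-== {suc n} zero    = trans (count-suc {n} (zero ==_)) (cong suc (count-false {n}))
count-== {suc n} (suc z) = trans (count-suc {n} (suc z ==_)) (trans (count-cong (suc-==-suc z)) (count-== z))

count-∧-== : ∀ {n} (p : Fin n → Bool) (z : Fin n) →
  count (λ w → p w ∧ (z == w)) ≡ indicator (p z)
count-∧-== {n} p z = trans (count-cong at-z) (by-value (p z))
  where
  at-z : ∀ w → (p w ∧ (z == w)) ≡ (p z ∧ (z == w))
  at-z w with z ≟ w
  ... | yes refl = refl
  ... | no _     = trans (∧-zeroʳ (p w)) (sym (∧-zeroʳ (p z)))
  by-value : ∀ b → count (λ w → b ∧ (z == w)) ≡ indicator b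
  by-value true  = count-== z
  by-value false = count-false {n}

isolate : ∀ {a b c x : ℤ} → a ≡ b + (c + x) → x ≡ a - b - c
isolate {b = b} {c} {x} refl = identity b c x
  where
  identity : ∀ b c x → x ≡ b + (c + x) - b - c
  identity = solve-∀

module _ {n : ℕ} (G : Graph n) where

  private
    Ḡ : Graph n
    Ḡ = complement G

  Distance≤2 : Set
  Distance≤2 = ∀ x y → x ≢ y →
    adj G x y ≡ true ⊎ Σ (Fin n) (λ w → adj G x w ≡ true × adj G w y ≡ true)

  adj⇒≢ : ∀ {y z} → adj G y z ≡ true → y ≢ z
  adj⇒≢ {y} yz refl with () ← trans (sym yz) (irrefl G y)

  adj-or-co-adj : ∀ {y z} → y ≢ z → adj G y z ≡ true ⊎ adj Ḡ y z ≡ true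
  adj-or-co-adj {y} {z} y≢z with y ≟ z | adj G y z
  ... | yes y≡z | _     = ⊥-elim (y≢z y≡z)
  ... | no _    | true  = inj₁ refl
  ... | no _    | false = inj₂ refl

  adj⇒¬co-adj : ∀ {y z} → adj G y z ≡ true → adj Ḡ y z ≡ false
  adj⇒¬co-adj {y} {z} yz rewrite yz = ∧-zeroʳ (not (y == z))

  co-adj⇒¬adj : ∀ {y z} → adj Ḡ y z ≡ true → adj G y z ≡ false
  co-adj⇒¬adj {y} {z} yz with adj G y z
  ... | true  = trans (sym yz) (∧-zeroʳ (not (y == z)))
  ... | false = refl

  complement-involutive : ∀ y z → adj (complement Ḡ) y z ≡ adj G y z
  complement-involutive y z with y ≟ z
  ... | yes refl = sym (irrefl G y)
  ... | no _     = not-involutive (adj G y z)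

  nbr2≡adj-complement : Distance≤2 → ∀ y z → nbr2 G y z ≡ adj Ḡ y z
  nbr2≡adj-complement dist y z with y ≟ z | adj G y z in yz
  ... | yes _  | _     = refl
  ... | no _   | true  = refl
  ... | no y≢z | false with dist y z y≢z
  ...   | inj₁ yz′             with () ← trans (sym yz′) yz
  ...   | inj₂ (w , yw , wz) = witness⇒exists? w (cong₂ _∧_ yw wz)

  count-around : (p : Fin n → Bool) (z : Fin n) →
    count p ≡ indicator (p z) +ℕ
      (count (λ w → p w ∧ adj G z w) +ℕ count (λ w → p w ∧ adj Ḡ z w))
  count-around p z = begin
    count p
      ≡⟨ count-split p (z ==_) ⟩
    count (λ w → p w ∧ (z == w)) +ℕ count (λ w → p w ∧ not (z == w))
      ≡⟨ cong₂ _+ℕ_ (count-∧-== p z) (count-split _ (adj G z)) ⟩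
    indicator (p z) +ℕ
      (count (λ w → (p w ∧ not (z == w)) ∧ adj G z w) +ℕ
       count (λ w → (p w ∧ not (z == w)) ∧ not (adj G z w)))
      ≡⟨ cong (indicator (p z) +ℕ_)
              (cong₂ _+ℕ_ (count-cong neighbours-differ) (count-cong (λ w → ∧-assoc (p w) _ _))) ⟩
    indicator (p z) +ℕ
      (count (λ w → p w ∧ adj G z w) +ℕ count (λ w → p w ∧ adj Ḡ z w)) ∎
    where
    open ≡-Reasoning
    neighbours-differ : ∀ w → ((p w ∧ not (z == w)) ∧ adj G z w) ≡ (p w ∧ adj G z w)
    neighbours-differ w with z ≟ w
    ... | yes refl rewrite irrefl G z = trans (∧-zeroʳ _) (sym (∧-zeroʳ (p z)))
    ... | no _     = cong (_∧ adj G z w) (∧-identityʳ (p w))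

  count-co-common : (p : Fin n → Bool) (z : Fin n) {a b c : ℤ} →
    + count p ≡ a → + indicator (p z) ≡ b → + count (λ w → p w ∧ adj G z w) ≡ c →
    + count (λ w → p w ∧ adj Ḡ z w) ≡ a - b - c
  count-co-common p z refl refl refl = isolate {b = + B} {+ C} (begin
    + count p                                  ≡⟨ cong +_ (count-around p z) ⟩
    + (B +ℕ (C +ℕ X))                          ≡⟨ pos-+ B (C +ℕ X) ⟩
    + B + + (C +ℕ X)                           ≡⟨ cong (_+_ (+ B)) (pos-+ C X) ⟩
    + B + (+ C + + X)                          ∎)
    where
    open ≡-Reasoning
    B = indicator (p z)
    C = count (λ w → p w ∧ adj G z w)
    X = count (λ w → p w ∧ adj Ḡ z w)

double-minus-self : ∀ x → + 2 * x - + 0 - x ≡ x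
double-minus-self = solve-∀

∧-true : ∀ {a b} → a ∧ b ≡ true → a ≡ true × b ≡ true
∧-true {true} b≡true = refl , b≡true

module ComplementOfExtensible {n : ℕ} (G : Graph n) {t s sb : ℤ}
  (diameter : Diameter2 G)
  (t≡ : t ≡ + 2 * s - sb - + 1)
  (degree : ∀ y → + count (adj G y) ≡ + 2 * s)
  (degree₂ : ∀ y → + count (nbr2 G y) ≡ + 2 * sb)
  (common-of-adjacent : ∀ y z → adj G y z ≡ true →
      (+ count (λ w → nbr2 G y w ∧ adj G z w) ≡ sb)
    × (+ count (λ w → adj G y w ∧ adj G z w) ≡ t))
  (common-of-distant : ∀ y z → nbr2 G y z ≡ true →
      (+ count (λ w → nbr2 G y w ∧ adj G z w) ≡ s)
    × (+ count (λ w → adj G y w ∧ adj G z w) ≡ s))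
  (order : + n ≡ + 1 + + 2 * s + + 2 * sb)
  where

  Ḡ : Graph n
  Ḡ = complement G

  nbr2≡co-adj : ∀ y z → nbr2 G y z ≡ adj Ḡ y z
  nbr2≡co-adj = nbr2≡adj-complement G (proj₁ diameter)

  co-degree : ∀ y → + count (adj Ḡ y) ≡ + 2 * sb
  co-degree y = trans (cong +_ (count-cong (λ w → sym (nbr2≡co-adj y w)))) (degree₂ y)

  count-co-adj≡count-nbr2 : ∀ y z → + count (λ w → adj Ḡ y w ∧ adj G z w) ≡
                          + count (λ w → nbr2 G y w ∧ adj G z w)
  count-co-adj≡count-nbr2 y z = cong +_ (count-∧-congˡ (adj G z) (λ w → sym (nbr2≡co-adj y w)))

  mixed-of-co-adjacent : ∀ y z → adj Ḡ y z ≡ true → + count (λ w → adj G y w ∧ adj Ḡ z w) ≡ s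
  mixed-of-co-adjacent y z yz =
    trans (count-co-common G (adj G y) z (degree y) (cong (+_ ∘ indicator) (co-adj⇒¬adj G yz))
                           (proj₂ (common-of-distant y z (trans (nbr2≡co-adj y z) yz))))
          (double-minus-self s)

  co-common-of-co-adjacent : ∀ y z → adj Ḡ y z ≡ true →
    + count (λ w → adj Ḡ y w ∧ adj Ḡ z w) ≡ + 2 * sb - s - + 1
  co-common-of-co-adjacent y z yz =
    trans (count-co-common G (adj Ḡ y) z (co-degree y) (cong (+_ ∘ indicator) yz)
            (trans (count-co-adj≡count-nbr2 y z) (proj₁ (common-of-distant y z (trans (nbr2≡co-adj y z) yz)))))
          (identity s sb)
    where
    identity : ∀ s sb → + 2 * sb - + 1 - s ≡ + 2 * sb - s - + 1
    identity = solve-∀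

  mixed-of-adjacent : ∀ y z → adj G y z ≡ true → + count (λ w → adj G y w ∧ adj Ḡ z w) ≡ sb
  mixed-of-adjacent y z yz =
    trans (count-co-common G (adj G y) z (degree y) (cong (+_ ∘ indicator) yz)
            (trans (proj₂ (common-of-adjacent y z yz)) t≡))
          (identity s sb)
    where
    identity : ∀ s sb → + 2 * s - + 1 - (+ 2 * s - sb - + 1) ≡ sb
    identity = solve-∀

  co-common-of-adjacent : ∀ y z → adj G y z ≡ true → + count (λ w → adj Ḡ y w ∧ adj Ḡ z w) ≡ sb
  co-common-of-adjacent y z yz =
    trans (count-co-common G (adj Ḡ y) z (co-degree y) (cong (+_ ∘ indicator) (adj⇒¬co-adj G yz))
            (trans (count-co-adj≡count-nbr2 y z) (proj₁ (common-of-adjacent y z yz))))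
          (double-minus-self sb)

  sb≢0 : sb ≢ + 0
  sb≢0 sb≡0 with proj₂ diameter
  ... | x , y , x≢y , xy with adj-or-co-adj G x≢y
  ...   | inj₁ xy′ with () ← trans (sym xy′) xy
  ...   | inj₂ x̄y = witness⇒count≢0 y x̄y (+-injective (trans (co-degree x) (cong (+ 2 *_) sb≡0)))

  co-distance≤2 : Distance≤2 Ḡ
  co-distance≤2 x y x≢y with adj-or-co-adj G x≢y
  ... | inj₂ x̄y = inj₁ x̄y
  ... | inj₁ xy
    with count≢0⇒witness (λ w → adj Ḡ x w ∧ adj Ḡ y w)
           (λ none → sb≢0 (trans (sym (co-common-of-adjacent x y xy)) (cong +_ none)))
  ...   | w , x̄w∧ȳw with ∧-true x̄w∧ȳw
  ...     | x̄w , ȳw = inj₂ (w , x̄w , trans (Graph.sym Ḡ w y) ȳw)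

  co-diameter2 : Diameter2 Ḡ
  co-diameter2 = co-distance≤2 , non-co-adjacent-pair
    where
    non-co-adjacent-pair : Σ (Fin n) (λ x → Σ (Fin n) (λ y → x ≢ y × adj Ḡ x y ≡ false))
    non-co-adjacent-pair with proj₂ diameter
    ... | x , y , x≢y , _ with proj₁ diameter x y x≢y
    ...   | inj₁ xy           = x , y , x≢y , adj⇒¬co-adj G xy
    ...   | inj₂ (w , xw , _) = x , w , adj⇒≢ G xw , adj⇒¬co-adj G xw

  co-nbr2≡adj : ∀ y z → nbr2 Ḡ y z ≡ adj G y z
  co-nbr2≡adj y z = trans (nbr2≡adj-complement Ḡ co-distance≤2 y z) (complement-involutive G y z)

  complement-extensible : Extensible Ḡ (+ 2 * sb - s - + 1) sb s
  complement-extensible =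
      co-diameter2
    , refl
    , co-degree
    , (λ y → trans (cong +_ (count-cong (co-nbr2≡adj y))) (degree y))
    , (λ y z yz → nbr2-co-common y z (mixed-of-co-adjacent y z yz) , co-common-of-co-adjacent y z yz)
    , (λ y z yz → let yz′ = trans (sym (co-nbr2≡adj y z)) yz in
                  nbr2-co-common y z (mixed-of-adjacent y z yz′) , co-common-of-adjacent y z yz′)
    , co-common-of-co-adjacent
    , trans order (identity s sb)
    where
    nbr2-co-common : ∀ y z {c} → + count (λ w → adj G y w ∧ adj Ḡ z w) ≡ c →
                     + count (λ w → nbr2 Ḡ y w ∧ adj Ḡ z w) ≡ c
    nbr2-co-common y z = trans (cong +_ (count-∧-congˡ (adj Ḡ z) (co-nbr2≡adj y)))
    identity : ∀ s sb → + 1 + + 2 * s + + 2 * sb ≡ + 1 + + 2 * sb + + 2 * s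
    identity = solve-∀

  parameter-sum : t + (+ 2 * sb - s - + 1) ≡ s + sb - + 2
  parameter-sum = trans (cong (_+ (+ 2 * sb - s - + 1)) t≡) (identity s sb)
    where
    identity : ∀ s sb → + 2 * s - sb - + 1 + (+ 2 * sb - s - + 1) ≡ s + sb - + 2
    identity = solve-∀

  parameter-sum′ : t + (+ 2 * sb - s - + 1) ≡ sb + s - + 2
  parameter-sum′ = trans parameter-sum (cong (_- + 2) (+-comm s sb))

proposition6 : {n : ℕ} (Λ : Graph n) (t s sb : ℤ) → Extensible Λ t s sb →
    Σ ℤ (λ tb → Σ ℤ (λ s′ → Σ ℤ (λ sb′ →
      Extensible (complement Λ) tb s′ sb′
      × s′ ≡ sb × sb′ ≡ s
      × t + tb ≡ s + sb - + 2
      × t + tb ≡ s′ + sb′ - + 2)))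
proposition6 Λ t s sb (diameter , t≡ , degree , degree₂ , common-of-adjacent , common-of-distant , _ , order) =
  + 2 * sb - s - + 1 , sb , s , complement-extensible , refl , refl , parameter-sum , parameter-sum′
  where
  open ComplementOfExtensible Λ diameter t≡ degree degree₂ common-of-adjacent common-of-distant order
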